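{- For $n\ge 3$ let $\alpha_n=\lceil 2^n/24\rceil$. Then $\theta(n,\alpha_n)-2\alpha_n=2^{n-3}$ and $\theta(n,2^{n-1}-\alpha_n)=5\cdot 2^{n-3}$.
   Context: For $S\subset\{0,1\}^n$, $\theta(n,S)$ is the number of edges of the hypercube $Q_n$ (vertices $\{0,1\}^n$, adjacent iff differing in one coordinate) with exactly one endpoint in $S$; $\theta(n,k)=\min\{\theta(n,S): |S|=k\}$. -}

module Defs where

open import Data.Bool using (Bool; true; false; _xor_)
open import Data.Nat using (ℕ; zero; suc; _+_; _≤_)
open import Data.Fin using (Fin)
open import Data.Vec using (Vec; []; _∷_; lookup; _[_]%=_)
open import Data.List using (List; []; _∷_; map; concatMap; length; filter; allFin)
open import Data.Product using (Σ; _×_; _,_)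
open import Relation.Binary.PropositionalEquality using (_≡_)
open import Data.Bool.Properties using () renaming (_≟_ to _≟ᵇ_)
open import Relation.Nullary.Decidable using (¬?)
open import Data.Bool using (not)

allVecs : (n : ℕ) → List (Vec Bool n)
allVecs zero    = [] ∷ []
allVecs (suc n) = concatMap (λ v → (false ∷ v) ∷ (true ∷ v) ∷ []) (allVecs n)

flip : {n : ℕ} → Vec Bool n → Fin n → Vec Bool n
flip x i = x [ i ]%= not

-- Edges of Q_n: each edge {x, flip x i} listed once, as (x , i) with x_i = 0.
edges : (n : ℕ) → List (Vec Bool n × Fin n)
edges n = concatMap (λ x → map (λ i → (x , i))
                              (filter (λ i → lookup x i ≟ᵇ false) (allFin n)))
                    (allVecs n)

Subset : ℕ → Set
Subset n = Vec Bool n → Bool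

card : {n : ℕ} → Subset n → ℕ
card {n} S = length (filter (λ x → S x ≟ᵇ true) (allVecs n))

θS : (n : ℕ) → Subset n → ℕ
θS n S = length (filter (λ e → edgeCut e ≟ᵇ true) (edges n))
  where
  edgeCut : Vec Bool n × Fin n → Bool
  edgeCut (x , i) = S x xor S (flip x i)

-- θ(n,k) = m : m is the minimum of θ(n,S) over subsets S with |S| = k
-- (attained, and a lower bound).
IsTheta : (n k m : ℕ) → Set
IsTheta n k m =
  Σ (Subset n) (λ S → (card S ≡ k) × (θS n S ≡ m))
  × ((S : Subset n) → card S ≡ k → m ≤ θS n S)

-- Harper's edge-isoperimetric inequality gives θ(n,k) = nk − 2hₙ(k) for k ≤ 2ⁿ, where hₙ(k) is the
-- number of edges inside the first k vertices in binary order. The lower bound is by induction on n,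
-- splitting S along the first coordinate into S₀ and S₁: exactly |S₀ △ S₁| ≥ ||S₀| − |S₁|| edges
-- cross between the halves, and h(a) + h(b) + min(a,b) ≤ h(a + b). Initial segments attain it.
-- The theorem is then an evaluation of h. Writing 2ⁿ⁻³ = 3u + 1 + p with p ∈ {0,1}, we have
-- αₙ = u + 1, and from n to n + 1 the number u doubles (p = 0) or doubles and adds one (p = 1);
-- the recursion of h carries the boundaries of the initial segments of sizes u and u + 1 along.
-- The identity 2h(2ᵈ − k) = d(2ᵈ − 2k) + 2h(k) transfers the value at α to 2ⁿ⁻¹ − α.

module Submission where

open import Defs
open import Data.Nat using (ℕ; _+_; _*_; _∸_; _^_; _≤_; _/_)
open import Data.Product using (_×_)
open import Data.Nat using (zero; suc; z≤n; s≤s; _<_; _⊓_; ⌊_/2⌋; ⌈_/2⌉; NonZero)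
open import Data.Nat.Properties
open import Data.Nat.DivMod using (m*n/n≡m; /-monoˡ-≤; m<n*o⇒m/o<n)
open import Data.Nat.Tactic.RingSolver using (solve-∀)
open import Data.Bool using (Bool; true; false; not; _xor_; if_then_else_)
open import Data.Bool.Properties using () renaming (_≟_ to _≟ᵇ_)
open import Data.List using (List; []; _∷_; _++_; map; concatMap; filter; length; tabulate; allFin)
open import Data.Vec using (Vec; []; _∷_; lookup)
open import Data.Fin using (Fin)
open import Data.Product using (_,_)
open import Data.Sum using (_⊎_; inj₁; inj₂)
open import Function using (_∘_; id)
open import Relation.Binary.PropositionalEquality

private variable A B : Set

∑ : List A → (A → ℕ) → ℕ
∑ []       f = 0
∑ (x ∷ xs) f = f x + ∑ xs f

∑-cong : ∀ {f g : A → ℕ} → (∀ x → f x ≡ g x) → ∀ xs → ∑ xs f ≡ ∑ xs g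
∑-cong f≗g []       = refl
∑-cong f≗g (x ∷ xs) = cong₂ _+_ (f≗g x) (∑-cong f≗g xs)

∑-mono-≤ : ∀ {f g : A → ℕ} → (∀ x → f x ≤ g x) → ∀ xs → ∑ xs f ≤ ∑ xs g
∑-mono-≤ f≤g []       = z≤n
∑-mono-≤ f≤g (x ∷ xs) = +-mono-≤ (f≤g x) (∑-mono-≤ f≤g xs)

∑-distrib-+ : ∀ (f g : A → ℕ) xs → ∑ xs (λ x → f x + g x) ≡ ∑ xs f + ∑ xs g
∑-distrib-+ f g []       = refl
∑-distrib-+ f g (x ∷ xs) = begin
  f x + g x + ∑ xs (λ x → f x + g x) ≡⟨ cong (f x + g x +_) (∑-distrib-+ f g xs) ⟩
  f x + g x + (∑ xs f + ∑ xs g)      ≡⟨ +-comm-middle (f x) (g x) (∑ xs f) (∑ xs g) ⟩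
  f x + ∑ xs f + (g x + ∑ xs g)      ∎
  where
  open ≡-Reasoning
  +-comm-middle : ∀ a b c d → a + b + (c + d) ≡ a + c + (b + d)
  +-comm-middle = solve-∀

∑-++ : ∀ (f : A → ℕ) xs ys → ∑ (xs ++ ys) f ≡ ∑ xs f + ∑ ys f
∑-++ f []       ys = refl
∑-++ f (x ∷ xs) ys = trans (cong (f x +_) (∑-++ f xs ys)) (sym (+-assoc (f x) _ _))

∑-filter-false : ∀ (f : A → ℕ) (P : A → Bool) xs →
  ∑ (filter (λ x → P x ≟ᵇ false) xs) f ≡ ∑ xs (λ x → if P x then 0 else f x)
∑-filter-false f P []       = refl
∑-filter-false f P (x ∷ xs) with P x
... | true  = ∑-filter-false f P xs
... | false = cong (f x +_) (∑-filter-false f P xs)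

∑-concatMap : ∀ (f : B → ℕ) (g : A → List B) xs → ∑ (concatMap g xs) f ≡ ∑ xs (λ x → ∑ (g x) f)
∑-concatMap f g []       = refl
∑-concatMap f g (x ∷ xs) = trans (∑-++ f (g x) (concatMap g xs)) (cong (∑ (g x) f +_) (∑-concatMap f g xs))

∑-map : ∀ (f : B → ℕ) (g : A → B) xs → ∑ (map g xs) f ≡ ∑ xs (f ∘ g)
∑-map f g []       = refl
∑-map f g (x ∷ xs) = cong (f (g x) +_) (∑-map f g xs)

∑-tabulate : ∀ n (g : Fin n → A) (f : A → ℕ) → ∑ (tabulate g) f ≡ ∑ (allFin n) (f ∘ g)
∑-tabulate zero    g f = refl
∑-tabulate (suc n) g f = cong (f (g Fin.zero) +_)
  (trans (∑-tabulate n (g ∘ Fin.suc) f) (sym (∑-tabulate n Fin.suc (f ∘ g))))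

indicator : Bool → ℕ
indicator true  = 1
indicator false = 0

length-filter-true : ∀ (P : A → Bool) xs → length (filter (λ x → P x ≟ᵇ true) xs) ≡ ∑ xs (indicator ∘ P)
length-filter-true P []       = refl
length-filter-true P (x ∷ xs) with P x
... | true  = cong suc (length-filter-true P xs)
... | false = length-filter-true P xs

-- The boundary of a subset of the cube

∑-allVecs-suc : ∀ n (f : Vec Bool (suc n) → ℕ) →
  ∑ (allVecs (suc n)) f ≡ ∑ (allVecs n) (f ∘ (false ∷_)) + ∑ (allVecs n) (f ∘ (true ∷_))
∑-allVecs-suc n f = begin
  ∑ (allVecs (suc n)) f
    ≡⟨ ∑-concatMap f _ (allVecs n) ⟩
  ∑ (allVecs n) (λ w → f (false ∷ w) + (f (true ∷ w) + 0))
    ≡⟨ ∑-cong (λ w → cong (f (false ∷ w) +_) (+-identityʳ _)) (allVecs n) ⟩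
  ∑ (allVecs n) (λ w → f (false ∷ w) + f (true ∷ w))
    ≡⟨ ∑-distrib-+ _ _ (allVecs n) ⟩
  ∑ (allVecs n) (f ∘ (false ∷_)) + ∑ (allVecs n) (f ∘ (true ∷_)) ∎
  where open ≡-Reasoning

size : (n : ℕ) → Subset n → ℕ
size n S = ∑ (allVecs n) (indicator ∘ S)

symDiff : (n : ℕ) → Subset n → Subset n → ℕ
symDiff n A B = ∑ (allVecs n) (λ w → indicator (A w xor B w))

slice : ∀ {n} → Subset (suc n) → Bool → Subset n
slice S b w = S (b ∷ w)

-- As in edges, the edge {x, flip x i} is counted at its endpoint with xᵢ = 0.
boundaryAt : (n : ℕ) → Subset n → Vec Bool n → ℕ
boundaryAt n S x = ∑ (allFin n) (λ i → if lookup x i then 0 else indicator (S x xor S (flip x i)))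

boundary : (n : ℕ) → Subset n → ℕ
boundary n S = ∑ (allVecs n) (boundaryAt n S)

card≡size : ∀ n (S : Subset n) → card S ≡ size n S
card≡size n S = length-filter-true S (allVecs n)

θS≡boundary : ∀ n (S : Subset n) → θS n S ≡ boundary n S
θS≡boundary n S = begin
  θS n S                                               ≡⟨ length-filter-true _ (edges n) ⟩
  ∑ (edges n) (indicator ∘ cut)                        ≡⟨ ∑-concatMap _ _ (allVecs n) ⟩
  ∑ (allVecs n) (λ x → ∑ (upEdges x) (indicator ∘ cut)) ≡⟨ ∑-cong atVertex (allVecs n) ⟩
  boundary n S                                         ∎
  where
  open ≡-Reasoning
  cut : Vec Bool n × Fin n → Bool
  cut (x , i) = S x xor S (flip x i)
  upEdges : Vec Bool n → List (Vec Bool n × Fin n)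
  upEdges x = map (x ,_) (filter (λ i → lookup x i ≟ᵇ false) (allFin n))
  atVertex : ∀ x → ∑ (upEdges x) (indicator ∘ cut) ≡ boundaryAt n S x
  atVertex x = trans (∑-map (indicator ∘ cut) (x ,_) (filter (λ i → lookup x i ≟ᵇ false) (allFin n)))
    (trans (∑-filter-false (λ i → indicator (cut (x , i))) (lookup x) (allFin n))
           (∑-tabulate n id _))

size-suc : ∀ n (S : Subset (suc n)) → size (suc n) S ≡ size n (slice S false) + size n (slice S true)
size-suc n S = ∑-allVecs-suc n (indicator ∘ S)

boundaryAt-∷ : ∀ n (S : Subset (suc n)) b w →
  boundaryAt (suc n) S (b ∷ w)
    ≡ (if b then 0 else indicator (S (b ∷ w) xor S (not b ∷ w))) + boundaryAt n (slice S b) w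
boundaryAt-∷ n S b w =
  cong ((if b then 0 else indicator (S (b ∷ w) xor S (not b ∷ w))) +_) (∑-tabulate n Fin.suc _)

boundary-suc : ∀ n (S : Subset (suc n)) →
  boundary (suc n) S
    ≡ boundary n (slice S false) + boundary n (slice S true) + symDiff n (slice S false) (slice S true)
boundary-suc n S = begin
  boundary (suc n) S
    ≡⟨ ∑-allVecs-suc n (boundaryAt (suc n) S) ⟩
  ∑ (allVecs n) (boundaryAt (suc n) S ∘ (false ∷_)) + ∑ (allVecs n) (boundaryAt (suc n) S ∘ (true ∷_))
    ≡⟨ cong₂ _+_ (∑-cong (boundaryAt-∷ n S false) (allVecs n)) (∑-cong (boundaryAt-∷ n S true) (allVecs n)) ⟩
  ∑ (allVecs n) (λ w → indicator (S₀ w xor S₁ w) + boundaryAt n S₀ w) + boundary n S₁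
    ≡⟨ cong (_+ boundary n S₁) (∑-distrib-+ _ _ (allVecs n)) ⟩
  symDiff n S₀ S₁ + boundary n S₀ + boundary n S₁
    ≡⟨ rotate (symDiff n S₀ S₁) (boundary n S₀) (boundary n S₁) ⟩
  boundary n S₀ + boundary n S₁ + symDiff n S₀ S₁ ∎
  where
  open ≡-Reasoning
  S₀ S₁ : Subset n
  S₀ = slice S false
  S₁ = slice S true
  rotate : ∀ a b c → a + b + c ≡ b + c + a
  rotate = solve-∀

size≤size+symDiff : ∀ n (A B : Subset n) → size n A ≤ size n B + symDiff n A B
size≤size+symDiff n A B =
  ≤-trans (∑-mono-≤ (λ w → pointwise (A w) (B w)) (allVecs n)) (≤-reflexive (∑-distrib-+ _ _ (allVecs n)))
  where
  pointwise : ∀ p q → indicator p ≤ indicator q + indicator (p xor q)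
  pointwise true  true  = s≤s z≤n
  pointwise true  false = s≤s z≤n
  pointwise false q     = z≤n

symDiff-comm : ∀ n (A B : Subset n) → symDiff n A B ≡ symDiff n B A
symDiff-comm n A B = ∑-cong (λ w → cong indicator (xor-comm (A w) (B w))) (allVecs n)
  where
  xor-comm : ∀ p q → p xor q ≡ q xor p
  xor-comm true  true  = refl
  xor-comm true  false = refl
  xor-comm false true  = refl
  xor-comm false false = refl

-- Harper's edge-isoperimetric inequality

⌈n/2⌉≡⌊n/2⌋⊎⌈n/2⌉≡1+⌊n/2⌋ : ∀ n → ⌈ n /2⌉ ≡ ⌊ n /2⌋ ⊎ ⌈ n /2⌉ ≡ suc ⌊ n /2⌋
⌈n/2⌉≡⌊n/2⌋⊎⌈n/2⌉≡1+⌊n/2⌋ zero          = inj₁ refl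
⌈n/2⌉≡⌊n/2⌋⊎⌈n/2⌉≡1+⌊n/2⌋ (suc zero)    = inj₂ refl
⌈n/2⌉≡⌊n/2⌋⊎⌈n/2⌉≡1+⌊n/2⌋ (suc (suc n)) with ⌈n/2⌉≡⌊n/2⌋⊎⌈n/2⌉≡1+⌊n/2⌋ n
... | inj₁ even = inj₁ (cong suc even)
... | inj₂ odd  = inj₂ (cong suc odd)

⌈n/2⌉≤1+⌊n/2⌋ : ∀ n → ⌈ n /2⌉ ≤ suc ⌊ n /2⌋
⌈n/2⌉≤1+⌊n/2⌋ n with ⌈n/2⌉≡⌊n/2⌋⊎⌈n/2⌉≡1+⌊n/2⌋ n
... | inj₁ even = ≤-trans (≤-reflexive even) (n≤1+n _)
... | inj₂ odd  = ≤-reflexive odd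

n≤1+2⌊n/2⌋ : ∀ n → n ≤ suc (⌊ n /2⌋ + ⌊ n /2⌋)
n≤1+2⌊n/2⌋ n = begin
  n                          ≡⟨ sym (⌊n/2⌋+⌈n/2⌉≡n n) ⟩
  ⌊ n /2⌋ + ⌈ n /2⌉          ≤⟨ +-monoʳ-≤ ⌊ n /2⌋ (⌈n/2⌉≤1+⌊n/2⌋ n) ⟩
  ⌊ n /2⌋ + suc ⌊ n /2⌋      ≡⟨ +-suc ⌊ n /2⌋ ⌊ n /2⌋ ⟩
  suc (⌊ n /2⌋ + ⌊ n /2⌋)    ∎
  where open ≤-Reasoning

⌊x+y/2⌋≡x : ∀ {x y} → x ≤ y → y ≤ suc x → ⌊ x + y /2⌋ ≡ x
⌊x+y/2⌋≡x {x} x≤y y≤1+x with m≤n⇒m<n∨m≡n y≤1+x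
... | inj₁ (s≤s y≤x) rewrite ≤-antisym y≤x x≤y = sym (n≡⌊n+n/2⌋ x)
... | inj₂ refl      rewrite +-suc x x         = sym (n≡⌈n+n/2⌉ x)

⌈x+y/2⌉≡y : ∀ {x y} → x ≤ y → y ≤ suc x → ⌈ x + y /2⌉ ≡ y
⌈x+y/2⌉≡y {x} {y} x≤y y≤1+x = +-cancelˡ-≡ x _ _ (begin
  x + ⌈ x + y /2⌉           ≡⟨ cong (_+ ⌈ x + y /2⌉) (sym (⌊x+y/2⌋≡x x≤y y≤1+x)) ⟩
  ⌊ x + y /2⌋ + ⌈ x + y /2⌉ ≡⟨ ⌊n/2⌋+⌈n/2⌉≡n (x + y) ⟩
  x + y                     ∎)
  where open ≡-Reasoning

-- For k ≤ 2ⁿ, the number of edges of Q_n inside its first k vertices in binary order (the halves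
-- ⌈k/2⌉, ⌊k/2⌋ sit in the two subcubes, matched by ⌊k/2⌋ edges); it equals the number of one-bits
-- in 0, 1, …, k − 1.
innerEdges : ℕ → ℕ → ℕ
innerEdges zero    k = 0
innerEdges (suc n) k = innerEdges n ⌈ k /2⌉ + innerEdges n ⌊ k /2⌋ + ⌊ k /2⌋

innerEdges-balanced : ∀ n {x y} → x ≤ y → y ≤ suc x →
  innerEdges (suc n) (x + y) ≡ innerEdges n y + innerEdges n x + x
innerEdges-balanced n x≤y y≤1+x
  rewrite ⌊x+y/2⌋≡x x≤y y≤1+x | ⌈x+y/2⌉≡y x≤y y≤1+x = refl

Superadditive : ℕ → Set
Superadditive n = ∀ {a b c} → c ≤ a → c ≤ b → innerEdges n a + innerEdges n b + c ≤ innerEdges (suc n) (a + b)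

superadditive-zero : Superadditive zero
superadditive-zero {a} {b} {c} c≤a c≤b = begin
  c               ≡⟨ n≡⌊n+n/2⌋ c ⟩
  ⌊ c + c /2⌋     ≤⟨ ⌊n/2⌋-mono (+-mono-≤ c≤a c≤b) ⟩
  ⌊ a + b /2⌋     ∎
  where open ≤-Reasoning

module _ (n : ℕ) (ih : Superadditive n) {a b c : ℕ} (c≤a : c ≤ a) (c≤b : c ≤ b) where

  private
    A₁ A₀ B₁ B₀ : ℕ
    A₁ = ⌈ a /2⌉
    A₀ = ⌊ a /2⌋
    B₁ = ⌈ b /2⌉
    B₀ = ⌊ b /2⌋

    h : ℕ → ℕ
    h = innerEdges n

    halves : A₀ + A₁ + (B₀ + B₁) ≡ a + b
    halves = cong₂ _+_ (⌊n/2⌋+⌈n/2⌉≡n a) (⌊n/2⌋+⌈n/2⌉≡n b)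

  superadditive-straight : A₁ + B₁ ≤ suc (A₀ + B₀) →
    innerEdges (suc n) a + innerEdges (suc n) b + c ≤ innerEdges (suc (suc n)) (a + b)
  superadditive-straight balanced = begin
    (h A₁ + h A₀ + A₀) + (h B₁ + h B₀ + B₀) + c
      ≡⟨ cong₂ _+_ refl (sym (⌊n/2⌋+⌈n/2⌉≡n c)) ⟩
    (h A₁ + h A₀ + A₀) + (h B₁ + h B₀ + B₀) + (⌊ c /2⌋ + ⌈ c /2⌉)
      ≡⟨ regroup (h A₁) (h A₀) A₀ (h B₁) (h B₀) B₀ ⌊ c /2⌋ ⌈ c /2⌉ ⟩
    (h A₁ + h B₁ + ⌈ c /2⌉) + (h A₀ + h B₀ + ⌊ c /2⌋) + (A₀ + B₀)
      ≤⟨ +-monoˡ-≤ (A₀ + B₀) (+-mono-≤ (ih (⌈n/2⌉-mono c≤a) (⌈n/2⌉-mono c≤b))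
                                       (ih (⌊n/2⌋-mono c≤a) (⌊n/2⌋-mono c≤b))) ⟩
    innerEdges (suc n) (A₁ + B₁) + innerEdges (suc n) (A₀ + B₀) + (A₀ + B₀)
      ≡⟨ sym (innerEdges-balanced (suc n) (+-mono-≤ (⌊n/2⌋≤⌈n/2⌉ a) (⌊n/2⌋≤⌈n/2⌉ b)) balanced) ⟩
    innerEdges (suc (suc n)) (A₀ + B₀ + (A₁ + B₁))
      ≡⟨ cong (innerEdges (suc (suc n))) (trans (+-comm-middle A₀ B₀ A₁ B₁) halves) ⟩
    innerEdges (suc (suc n)) (a + b) ∎
    where
    open ≤-Reasoning
    regroup : ∀ ha₁ ha₀ a₀ hb₁ hb₀ b₀ c₀ c₁ →
      (ha₁ + ha₀ + a₀) + (hb₁ + hb₀ + b₀) + (c₀ + c₁)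
        ≡ (ha₁ + hb₁ + c₁) + (ha₀ + hb₀ + c₀) + (a₀ + b₀)
    regroup = solve-∀
    +-comm-middle : ∀ w x y z → w + x + (y + z) ≡ w + y + (x + z)
    +-comm-middle = solve-∀

  -- With a and b both odd, ⌈a/2⌉ + ⌈b/2⌉ exceeds the upper half of a + b, so the halves are crossed.
  superadditive-crossed : A₁ ≡ suc A₀ → B₁ ≡ suc B₀ →
    innerEdges (suc n) a + innerEdges (suc n) b + c ≤ innerEdges (suc (suc n)) (a + b)
  superadditive-crossed a-odd b-odd = begin
    (h A₁ + h A₀ + A₀) + (h B₁ + h B₀ + B₀) + c
      ≤⟨ +-monoʳ-≤ _ (n≤1+2⌊n/2⌋ c) ⟩
    (h A₁ + h A₀ + A₀) + (h B₁ + h B₀ + B₀) + suc (c′ + c′)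
      ≡⟨ regroup (h A₁) (h A₀) A₀ (h B₁) (h B₀) B₀ c′ ⟩
    (h A₁ + h B₀ + c′) + (h A₀ + h B₁ + c′) + suc (A₀ + B₀)
      ≤⟨ +-monoˡ-≤ (suc (A₀ + B₀))
           (+-mono-≤ (ih (≤-trans (⌊n/2⌋-mono c≤a) (⌊n/2⌋≤⌈n/2⌉ a)) (⌊n/2⌋-mono c≤b))
                     (ih (⌊n/2⌋-mono c≤a) (≤-trans (⌊n/2⌋-mono c≤b) (⌊n/2⌋≤⌈n/2⌉ b)))) ⟩
    innerEdges (suc n) (A₁ + B₀) + innerEdges (suc n) (A₀ + B₁) + suc (A₀ + B₀)
      ≡⟨ cong₂ (λ s t → innerEdges (suc n) s + innerEdges (suc n) (A₀ + B₁) + t)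
               A₁+B₀≡A₀+B₁ 1+A₀+B₀≡A₀+B₁ ⟩
    innerEdges (suc n) (A₀ + B₁) + innerEdges (suc n) (A₀ + B₁) + (A₀ + B₁)
      ≡⟨ sym (innerEdges-balanced (suc n) ≤-refl (n≤1+n _)) ⟩
    innerEdges (suc (suc n)) (A₀ + B₁ + (A₀ + B₁))
      ≡⟨ cong (λ s → innerEdges (suc (suc n)) (A₀ + B₁ + s)) (sym A₁+B₀≡A₀+B₁) ⟩
    innerEdges (suc (suc n)) (A₀ + B₁ + (A₁ + B₀))
      ≡⟨ cong (innerEdges (suc (suc n))) (trans (swap A₀ B₁ A₁ B₀) halves) ⟩
    innerEdges (suc (suc n)) (a + b) ∎
    where
    open ≤-Reasoning
    c′ : ℕ
    c′ = ⌊ c /2⌋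
    1+A₀+B₀≡A₀+B₁ : suc (A₀ + B₀) ≡ A₀ + B₁
    1+A₀+B₀≡A₀+B₁ = trans (sym (+-suc A₀ B₀)) (cong (A₀ +_) (sym b-odd))
    A₁+B₀≡A₀+B₁ : A₁ + B₀ ≡ A₀ + B₁
    A₁+B₀≡A₀+B₁ = trans (cong (_+ B₀) a-odd) 1+A₀+B₀≡A₀+B₁
    regroup : ∀ ha₁ ha₀ a₀ hb₁ hb₀ b₀ c′ →
      (ha₁ + ha₀ + a₀) + (hb₁ + hb₀ + b₀) + suc (c′ + c′)
        ≡ (ha₁ + hb₀ + c′) + (ha₀ + hb₁ + c′) + suc (a₀ + b₀)
    regroup = solve-∀
    swap : ∀ w x y z → w + x + (y + z) ≡ w + y + (z + x)
    swap = solve-∀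

superadditive-suc : ∀ n → Superadditive n → Superadditive (suc n)
superadditive-suc n ih {a} {b} c≤a c≤b
  with ⌈n/2⌉≡⌊n/2⌋⊎⌈n/2⌉≡1+⌊n/2⌋ a | ⌈n/2⌉≡⌊n/2⌋⊎⌈n/2⌉≡1+⌊n/2⌋ b
... | inj₁ a-even | _ = superadditive-straight n ih c≤a c≤b (begin
  ⌈ a /2⌉ + ⌈ b /2⌉       ≡⟨ cong (_+ ⌈ b /2⌉) a-even ⟩
  ⌊ a /2⌋ + ⌈ b /2⌉       ≤⟨ +-monoʳ-≤ ⌊ a /2⌋ (⌈n/2⌉≤1+⌊n/2⌋ b) ⟩
  ⌊ a /2⌋ + suc ⌊ b /2⌋   ≡⟨ +-suc ⌊ a /2⌋ ⌊ b /2⌋ ⟩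
  suc (⌊ a /2⌋ + ⌊ b /2⌋) ∎)
  where open ≤-Reasoning
... | inj₂ a-odd | inj₁ b-even = superadditive-straight n ih c≤a c≤b
  (≤-reflexive (cong₂ _+_ a-odd b-even))
... | inj₂ a-odd | inj₂ b-odd = superadditive-crossed n ih c≤a c≤b a-odd b-odd

superadditive : ∀ n → Superadditive n
superadditive zero    = superadditive-zero
superadditive (suc n) = superadditive-suc n (superadditive n)

m+n≤d+m⊓n+m⊓n : ∀ {m n d} → m ≤ n + d → n ≤ m + d → m + n ≤ d + m ⊓ n + m ⊓ n
m+n≤d+m⊓n+m⊓n {m} {n} {d} m≤n+d n≤m+d with ≤-total m n
... | inj₁ m≤n rewrite m≤n⇒m⊓n≡m m≤n = begin
  m + n       ≤⟨ +-monoʳ-≤ m n≤m+d ⟩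
  m + (m + d) ≡⟨ rearrange m d ⟩
  d + m + m   ∎
  where
  open ≤-Reasoning
  rearrange : ∀ m d → m + (m + d) ≡ d + m + m
  rearrange = solve-∀
... | inj₂ n≤m rewrite m≥n⇒m⊓n≡n n≤m = begin
  m + n       ≤⟨ +-monoˡ-≤ n m≤n+d ⟩
  n + d + n   ≡⟨ cong (_+ n) (+-comm n d) ⟩
  d + n + n   ∎
  where open ≤-Reasoning

edge-isoperimetric : ∀ n (S : Subset n) → n * size n S ≤ boundary n S + 2 * innerEdges n (size n S)
edge-isoperimetric zero    S = z≤n
edge-isoperimetric (suc n) S = begin
  suc n * size (suc n) S
    ≡⟨ cong (suc n *_) (size-suc n S) ⟩
  suc n * (a + b)
    ≡⟨ expand n a b ⟩
  (a + b) + (n * a + n * b)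
    ≤⟨ +-mono-≤ (m+n≤d+m⊓n+m⊓n a≤b+d b≤a+d)
                (+-mono-≤ (edge-isoperimetric n S₀) (edge-isoperimetric n S₁)) ⟩
  (d + c + c) + ((∂₀ + 2 * h a) + (∂₁ + 2 * h b))
    ≡⟨ regroup d c ∂₀ (h a) ∂₁ (h b) ⟩
  ∂₀ + ∂₁ + d + 2 * (h a + h b + c)
    ≤⟨ +-monoʳ-≤ (∂₀ + ∂₁ + d) (*-monoʳ-≤ 2 (superadditive n (m⊓n≤m a b) (m⊓n≤n a b))) ⟩
  ∂₀ + ∂₁ + d + 2 * innerEdges (suc n) (a + b)
    ≡⟨ cong₂ (λ s t → s + 2 * innerEdges (suc n) t) (sym (boundary-suc n S)) (sym (size-suc n S)) ⟩
  boundary (suc n) S + 2 * innerEdges (suc n) (size (suc n) S) ∎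
  where
  open ≤-Reasoning
  S₀ S₁ : Subset n
  S₀ = slice S false
  S₁ = slice S true
  a b c d ∂₀ ∂₁ : ℕ
  a = size n S₀
  b = size n S₁
  c = a ⊓ b
  d = symDiff n S₀ S₁
  ∂₀ = boundary n S₀
  ∂₁ = boundary n S₁
  a≤b+d : a ≤ b + d
  a≤b+d = size≤size+symDiff n S₀ S₁
  b≤a+d : b ≤ a + d
  b≤a+d = subst (λ e → b ≤ a + e) (symDiff-comm n S₁ S₀) (size≤size+symDiff n S₁ S₀)
  h : ℕ → ℕ
  h = innerEdges n
  expand : ∀ n a b → suc n * (a + b) ≡ (a + b) + (n * a + n * b)
  expand = solve-∀
  regroup : ∀ d c ∂₀ ha ∂₁ hb →
    (d + c + c) + ((∂₀ + 2 * ha) + (∂₁ + 2 * hb)) ≡ ∂₀ + ∂₁ + d + 2 * (ha + hb + c)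
  regroup = solve-∀

-- Initial segments attain the bound

-- The vertices x with ∑ xᵢ 2ⁱ < k.
initialSegment : (n : ℕ) → ℕ → Subset n
initialSegment zero    zero    []          = false
initialSegment zero    (suc k) []          = true
initialSegment (suc n) k       (false ∷ w) = initialSegment n ⌈ k /2⌉ w
initialSegment (suc n) k       (true  ∷ w) = initialSegment n ⌊ k /2⌋ w

initialSegment-mono : ∀ n {j k} → j ≤ k → ∀ w → initialSegment n j w ≡ true → initialSegment n k w ≡ true
initialSegment-mono zero    {suc j} {suc k} _   []          _   = refl
initialSegment-mono (suc n)                 j≤k (false ∷ w) w∈I = initialSegment-mono n (⌈n/2⌉-mono j≤k) w w∈I
initialSegment-mono (suc n)                 j≤k (true  ∷ w) w∈I = initialSegment-mono n (⌊n/2⌋-mono j≤k) w w∈I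

⌈k/2⌉≤2^n : ∀ n {k} → k ≤ 2 ^ suc n → ⌈ k /2⌉ ≤ 2 ^ n
⌈k/2⌉≤2^n n {k} k≤2^[1+n] = begin
  ⌈ k /2⌉             ≤⟨ ⌈n/2⌉-mono (≤-trans k≤2^[1+n] (≤-reflexive 2^[1+n]≡2^n+2^n)) ⟩
  ⌈ 2 ^ n + 2 ^ n /2⌉ ≡⟨ sym (n≡⌈n+n/2⌉ (2 ^ n)) ⟩
  2 ^ n               ∎
  where
  open ≤-Reasoning
  2^[1+n]≡2^n+2^n : 2 ^ suc n ≡ 2 ^ n + 2 ^ n
  2^[1+n]≡2^n+2^n = cong (2 ^ n +_) (+-identityʳ (2 ^ n))

⌊k/2⌋≤2^n : ∀ n {k} → k ≤ 2 ^ suc n → ⌊ k /2⌋ ≤ 2 ^ n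
⌊k/2⌋≤2^n n {k} k≤2^[1+n] = ≤-trans (⌊n/2⌋≤⌈n/2⌉ k) (⌈k/2⌉≤2^n n k≤2^[1+n])

size-initialSegment : ∀ n k → k ≤ 2 ^ n → size n (initialSegment n k) ≡ k
size-initialSegment zero    zero          _              = refl
size-initialSegment zero    (suc zero)    _              = refl
size-initialSegment zero    (suc (suc k)) (s≤s ())
size-initialSegment (suc n) k             k≤2^[1+n]      = begin
  size (suc n) (initialSegment (suc n) k)
    ≡⟨ size-suc n (initialSegment (suc n) k) ⟩
  size n (initialSegment n ⌈ k /2⌉) + size n (initialSegment n ⌊ k /2⌋)
    ≡⟨ cong₂ _+_ (size-initialSegment n ⌈ k /2⌉ (⌈k/2⌉≤2^n n k≤2^[1+n]))
                 (size-initialSegment n ⌊ k /2⌋ (⌊k/2⌋≤2^n n k≤2^[1+n])) ⟩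
  ⌈ k /2⌉ + ⌊ k /2⌋
    ≡⟨ +-comm ⌈ k /2⌉ ⌊ k /2⌋ ⟩
  ⌊ k /2⌋ + ⌈ k /2⌉
    ≡⟨ ⌊n/2⌋+⌈n/2⌉≡n k ⟩
  k ∎
  where open ≡-Reasoning

symDiff+size≡size : ∀ n (A B : Subset n) → (∀ w → B w ≡ true → A w ≡ true) →
  symDiff n A B + size n B ≡ size n A
symDiff+size≡size n A B B⊆A =
  trans (sym (∑-distrib-+ _ _ (allVecs n))) (∑-cong (λ w → pointwise (A w) (B w) (B⊆A w)) (allVecs n))
  where
  pointwise : ∀ p q → (q ≡ true → p ≡ true) → indicator (p xor q) + indicator q ≡ indicator p
  pointwise true  true  _    = refl
  pointwise true  false _    = refl
  pointwise false false _    = refl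
  pointwise false true  q⇒p with q⇒p refl
  ... | ()

boundary-initialSegment : ∀ n k → k ≤ 2 ^ n → boundary n (initialSegment n k) + 2 * innerEdges n k ≡ n * k
boundary-initialSegment zero    k _         = refl
boundary-initialSegment (suc n) k k≤2^[1+n] = begin
  boundary (suc n) (initialSegment (suc n) k) + 2 * innerEdges (suc n) k
    ≡⟨ cong (_+ 2 * innerEdges (suc n) k) (boundary-suc n (initialSegment (suc n) k)) ⟩
  ∂₁ + ∂₀ + δ + 2 * (h k₁ + h k₀ + k₀)
    ≡⟨ regroup ∂₁ ∂₀ δ (h k₁) (h k₀) k₀ ⟩
  (∂₁ + 2 * h k₁) + (∂₀ + 2 * h k₀) + (δ + k₀) + k₀
    ≡⟨ cong₂ (λ s t → s + t + k₀)
             (cong₂ _+_ (boundary-initialSegment n k₁ k₁≤2^n) (boundary-initialSegment n k₀ k₀≤2^n))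
             δ+k₀≡k₁ ⟩
  n * k₁ + n * k₀ + k₁ + k₀
    ≡⟨ collect n k₁ k₀ ⟩
  suc n * (k₀ + k₁)
    ≡⟨ cong (suc n *_) (⌊n/2⌋+⌈n/2⌉≡n k) ⟩
  suc n * k ∎
  where
  open ≡-Reasoning
  k₁ k₀ : ℕ
  k₁ = ⌈ k /2⌉
  k₀ = ⌊ k /2⌋
  k₁≤2^n : k₁ ≤ 2 ^ n
  k₁≤2^n = ⌈k/2⌉≤2^n n k≤2^[1+n]
  k₀≤2^n : k₀ ≤ 2 ^ n
  k₀≤2^n = ⌊k/2⌋≤2^n n k≤2^[1+n]
  I₁ I₀ : Subset n
  I₁ = initialSegment n k₁
  I₀ = initialSegment n k₀
  h : ℕ → ℕ
  h = innerEdges n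
  ∂₁ ∂₀ δ : ℕ
  ∂₁ = boundary n I₁
  ∂₀ = boundary n I₀
  δ = symDiff n I₁ I₀
  δ+k₀≡k₁ : δ + k₀ ≡ k₁
  δ+k₀≡k₁ = begin
    δ + k₀         ≡⟨ cong (δ +_) (sym (size-initialSegment n k₀ k₀≤2^n)) ⟩
    δ + size n I₀  ≡⟨ symDiff+size≡size n I₁ I₀ (initialSegment-mono n (⌊n/2⌋≤⌈n/2⌉ k)) ⟩
    size n I₁      ≡⟨ size-initialSegment n k₁ k₁≤2^n ⟩
    k₁             ∎
  regroup : ∀ ∂₁ ∂₀ δ h₁ h₀ k₀ →
    ∂₁ + ∂₀ + δ + 2 * (h₁ + h₀ + k₀) ≡ (∂₁ + 2 * h₁) + (∂₀ + 2 * h₀) + (δ + k₀) + k₀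
  regroup = solve-∀
  collect : ∀ n k₁ k₀ → n * k₁ + n * k₀ + k₁ + k₀ ≡ suc n * (k₀ + k₁)
  collect = solve-∀

isTheta-initialSegment : ∀ n k m → k ≤ 2 ^ n → 2 * innerEdges n k + m ≡ n * k → IsTheta n k m
isTheta-initialSegment n k m k≤2^n 2h+m≡nk = (I , card-I , θ-I) , lower-bound
  where
  I : Subset n
  I = initialSegment n k
  H : ℕ
  H = 2 * innerEdges n k
  card-I : card I ≡ k
  card-I = trans (card≡size n I) (size-initialSegment n k k≤2^n)
  θ-I : θS n I ≡ m
  θ-I = +-cancelˡ-≡ H _ _ (begin
    H + θS n I        ≡⟨ +-comm H (θS n I) ⟩
    θS n I + H        ≡⟨ cong (_+ H) (θS≡boundary n I) ⟩
    boundary n I + H  ≡⟨ boundary-initialSegment n k k≤2^n ⟩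
    n * k             ≡⟨ sym 2h+m≡nk ⟩
    H + m             ∎)
    where open ≡-Reasoning
  lower-bound : (S : Subset n) → card S ≡ k → m ≤ θS n S
  lower-bound S |S|≡k = +-cancelˡ-≤ H _ _ (begin
    H + m                                       ≡⟨ 2h+m≡nk ⟩
    n * k                                       ≡⟨ cong (n *_) (sym |S|≡size) ⟩
    n * size n S                                ≤⟨ edge-isoperimetric n S ⟩
    boundary n S + 2 * innerEdges n (size n S)  ≡⟨ cong₂ (λ s t → s + 2 * innerEdges n t) (sym (θS≡boundary n S))
                                                         |S|≡size ⟩
    θS n S + H                                  ≡⟨ +-comm (θS n S) H ⟩
    H + θS n S                                  ∎)
    where
    open ≤-Reasoning
    |S|≡size : size n S ≡ k
    |S|≡size = trans (sym (card≡size n S)) |S|≡k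

-- Evaluation at αₙ and 2ⁿ⁻¹ − αₙ

innerEdges-double : ∀ n x → innerEdges (suc n) (x + x) ≡ innerEdges n x + innerEdges n x + x
innerEdges-double n x = innerEdges-balanced n ≤-refl (n≤1+n x)

innerEdges-double+1 : ∀ n x → innerEdges (suc n) (suc (x + x)) ≡ innerEdges n (suc x) + innerEdges n x + x
innerEdges-double+1 n x =
  trans (cong (innerEdges (suc n)) (sym (+-suc x x))) (innerEdges-balanced n (n≤1+n x) ≤-refl)

innerEdges-stable : ∀ n k → k ≤ 2 ^ n → innerEdges (suc n) k ≡ innerEdges n k
innerEdges-stable zero    zero       _         = refl
innerEdges-stable zero    (suc zero) _         = refl
innerEdges-stable zero    (suc (suc k)) (s≤s ())
innerEdges-stable (suc n) k          k≤2^[1+n] =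
  cong₂ (λ s t → s + t + ⌊ k /2⌋) (innerEdges-stable n ⌈ k /2⌉ (⌈k/2⌉≤2^n n k≤2^[1+n]))
                                  (innerEdges-stable n ⌊ k /2⌋ (⌊k/2⌋≤2^n n k≤2^[1+n]))

innerEdges-complement : ∀ n k → k ≤ 2 ^ n →
  2 * innerEdges n (2 ^ n ∸ k) + 2 * (n * k) ≡ n * 2 ^ n + 2 * innerEdges n k
innerEdges-complement zero    k _         = refl
innerEdges-complement (suc n) k k≤2^[1+n] = begin
  2 * innerEdges (suc n) (2 ^ suc n ∸ k) + 2 * (suc n * k)
    ≡⟨ cong₂ (λ s t → 2 * s + 2 * (suc n * t)) complement-halves (sym (⌊n/2⌋+⌈n/2⌉≡n k)) ⟩
  2 * (h Y + h X + X) + 2 * (suc n * (k₀ + k₁))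
    ≡⟨ regroup n (h X) (h Y) X k₁ k₀ ⟩
  (2 * h X + 2 * (n * k₁)) + (2 * h Y + 2 * (n * k₀)) + 2 * (X + k₁) + 2 * k₀
    ≡⟨ cong₂ (λ s t → s + t + 2 * (X + k₁) + 2 * k₀)
             (innerEdges-complement n k₁ k₁≤N) (innerEdges-complement n k₀ k₀≤N) ⟩
  (n * N + 2 * h k₁) + (n * N + 2 * h k₀) + 2 * (X + k₁) + 2 * k₀
    ≡⟨ cong (λ s → (n * N + 2 * h k₁) + (n * N + 2 * h k₀) + 2 * s + 2 * k₀) (m∸n+n≡m k₁≤N) ⟩
  (n * N + 2 * h k₁) + (n * N + 2 * h k₀) + 2 * N + 2 * k₀
    ≡⟨ collect n N (h k₁) (h k₀) k₀ ⟩
  suc n * (2 * N) + 2 * innerEdges (suc n) k ∎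
  where
  open ≡-Reasoning
  N k₁ k₀ X Y : ℕ
  N = 2 ^ n
  k₁ = ⌈ k /2⌉
  k₀ = ⌊ k /2⌋
  X = N ∸ k₁
  Y = N ∸ k₀
  h : ℕ → ℕ
  h = innerEdges n
  k₁≤N : k₁ ≤ N
  k₁≤N = ⌈k/2⌉≤2^n n k≤2^[1+n]
  k₀≤N : k₀ ≤ N
  k₀≤N = ⌊k/2⌋≤2^n n k≤2^[1+n]
  X≤Y : X ≤ Y
  X≤Y = ∸-monoʳ-≤ N (⌊n/2⌋≤⌈n/2⌉ k)
  Y≤1+X : Y ≤ suc X
  Y≤1+X = ≤-trans (∸-monoʳ-≤ (suc N) (⌈n/2⌉≤1+⌊n/2⌋ k)) (≤-reflexive (+-∸-assoc 1 k₁≤N))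
  X+Y+k≡2N : X + Y + k ≡ 2 ^ suc n
  X+Y+k≡2N = begin
    X + Y + k               ≡⟨ cong (X + Y +_) (sym (⌊n/2⌋+⌈n/2⌉≡n k)) ⟩
    X + Y + (k₀ + k₁)       ≡⟨ interleave X Y k₀ k₁ ⟩
    (X + k₁) + (Y + k₀)     ≡⟨ cong₂ _+_ (m∸n+n≡m k₁≤N) (m∸n+n≡m k₀≤N) ⟩
    N + N                   ≡⟨ cong (N +_) (sym (+-identityʳ N)) ⟩
    2 ^ suc n               ∎
    where
    interleave : ∀ x y a b → x + y + (a + b) ≡ (x + b) + (y + a)
    interleave = solve-∀
  complement-halves : innerEdges (suc n) (2 ^ suc n ∸ k) ≡ h Y + h X + X
  complement-halves = begin
    innerEdges (suc n) (2 ^ suc n ∸ k)   ≡⟨ cong (λ s → innerEdges (suc n) (s ∸ k)) (sym X+Y+k≡2N) ⟩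
    innerEdges (suc n) (X + Y + k ∸ k)   ≡⟨ cong (innerEdges (suc n)) (m+n∸n≡m (X + Y) k) ⟩
    innerEdges (suc n) (X + Y)           ≡⟨ innerEdges-balanced n X≤Y Y≤1+X ⟩
    h Y + h X + X                        ∎
  regroup : ∀ n hX hY X k₁ k₀ → 2 * (hY + hX + X) + 2 * (suc n * (k₀ + k₁))
    ≡ (2 * hX + 2 * (n * k₁)) + (2 * hY + 2 * (n * k₀)) + 2 * (X + k₁) + 2 * k₀
  regroup = solve-∀
  collect : ∀ n N h₁ h₀ k₀ → (n * N + 2 * h₁) + (n * N + 2 * h₀) + 2 * N + 2 * k₀
    ≡ suc n * (2 * N) + 2 * (h₁ + h₀ + k₀)
  collect = solve-∀

-- The initial segments of sizes k and 2ᵈ − k of Q_{d+1} have boundaries differing by 2ᵈ − 2k.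
innerEdges-lower-complement : ∀ d k → k ≤ 2 ^ d →
  suc d * (2 ^ d ∸ k) + 2 * k + 2 * innerEdges (suc d) k ≡ suc d * k + 2 ^ d + 2 * innerEdges (suc d) (2 ^ d ∸ k)
innerEdges-lower-complement d k k≤2^d = +-cancelʳ-≡ (2 * (d * k)) _ _ (begin
  suc d * v + 2 * k + 2 * h k + 2 * (d * k)
    ≡⟨ regroup₁ d v k (h k) ⟩
  suc d * (v + k) + suc d * k + 2 * h k
    ≡⟨ cong (λ s → suc d * s + suc d * k + 2 * h k) v+k≡2^d ⟩
  suc d * 2 ^ d + suc d * k + 2 * h k
    ≡⟨ regroup₂ d (2 ^ d) k (h k) ⟩
  suc d * k + 2 ^ d + (d * 2 ^ d + 2 * h k)
    ≡⟨ cong (suc d * k + 2 ^ d +_) (sym complement) ⟩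
  suc d * k + 2 ^ d + (2 * h v + 2 * (d * k))
    ≡⟨ sym (+-assoc (suc d * k + 2 ^ d) _ _) ⟩
  suc d * k + 2 ^ d + 2 * h v + 2 * (d * k) ∎)
  where
  open ≡-Reasoning
  v : ℕ
  v = 2 ^ d ∸ k
  h : ℕ → ℕ
  h = innerEdges (suc d)
  v+k≡2^d : v + k ≡ 2 ^ d
  v+k≡2^d = m∸n+n≡m k≤2^d
  complement : 2 * h v + 2 * (d * k) ≡ d * 2 ^ d + 2 * h k
  complement = begin
    2 * h v + 2 * (d * k)
      ≡⟨ cong (λ s → 2 * s + 2 * (d * k)) (innerEdges-stable d v (m∸n≤m (2 ^ d) k)) ⟩
    2 * innerEdges d v + 2 * (d * k)
      ≡⟨ innerEdges-complement d k k≤2^d ⟩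
    d * 2 ^ d + 2 * innerEdges d k
      ≡⟨ cong (λ s → d * 2 ^ d + 2 * s) (sym (innerEdges-stable d k k≤2^d)) ⟩
    d * 2 ^ d + 2 * h k ∎
  regroup₁ : ∀ d v k hk → suc d * v + 2 * k + 2 * hk + 2 * (d * k) ≡ suc d * (v + k) + suc d * k + 2 * hk
  regroup₁ = solve-∀
  regroup₂ : ∀ d N k hk → suc d * N + suc d * k + 2 * hk ≡ suc d * k + N + (d * N + 2 * hk)
  regroup₂ = solve-∀

double-recurrence : ∀ n P x →
  2 * innerEdges (suc n) (x + x) + 2 * (x + x) + 2 * P ≡ 2 * (2 * innerEdges n x + 2 * x + P) + 2 * x
double-recurrence n P x = begin
  2 * innerEdges (suc n) (x + x) + 2 * (x + x) + 2 * P
    ≡⟨ cong (λ s → 2 * s + 2 * (x + x) + 2 * P) (innerEdges-double n x) ⟩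
  2 * (h x + h x + x) + 2 * (x + x) + 2 * P
    ≡⟨ regroup (h x) x P ⟩
  2 * (2 * h x + 2 * x + P) + 2 * x ∎
  where
  open ≡-Reasoning
  h : ℕ → ℕ
  h = innerEdges n
  regroup : ∀ hx x P → 2 * (hx + hx + x) + 2 * (x + x) + 2 * P ≡ 2 * (2 * hx + 2 * x + P) + 2 * x
  regroup = solve-∀

double+1-recurrence : ∀ n P x →
  2 * innerEdges (suc n) (suc (x + x)) + 2 * suc (x + x) + 2 * P
    ≡ (2 * innerEdges n (suc x) + 2 * suc x + P) + (2 * innerEdges n x + 2 * x + P) + 2 * x
double+1-recurrence n P x = begin
  2 * innerEdges (suc n) (suc (x + x)) + 2 * suc (x + x) + 2 * P
    ≡⟨ cong (λ s → 2 * s + 2 * suc (x + x) + 2 * P) (innerEdges-double+1 n x) ⟩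
  2 * (h (suc x) + h x + x) + 2 * suc (x + x) + 2 * P
    ≡⟨ regroup (h (suc x)) (h x) x P ⟩
  (2 * h (suc x) + 2 * suc x + P) + (2 * h x + 2 * x + P) + 2 * x ∎
  where
  open ≡-Reasoning
  h : ℕ → ℕ
  h = innerEdges n
  regroup : ∀ hx₁ hx x P →
    2 * (hx₁ + hx + x) + 2 * suc (x + x) + 2 * P ≡ (2 * hx₁ + 2 * suc x + P) + (2 * hx + 2 * x + P) + 2 * x
  regroup = solve-∀

-- u = ⌊2ᵐ/3⌋, where 2ᵐ ≡ 1 + p (mod 3); the other two fields say that in Q_{m+3} the initial
-- segments of sizes u + 1 and u have boundaries 2(u + 1) + 2ᵐ and 2u + 2ᵐ − 1 − p.
record Third (m p : ℕ) : Set where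
  field
    u        : ℕ
    u-spec   : 3 * u + 1 + p ≡ 2 ^ m
    at-suc-u : 2 * innerEdges (3 + m) (suc u) + 2 * suc u + 2 ^ m ≡ (3 + m) * suc u
    at-u     : 2 * innerEdges (3 + m) u + 2 * u + 2 ^ m ≡ (3 + m) * u + suc p

third-zero : Third 0 0
third-zero = record { u = 0 ; u-spec = refl ; at-suc-u = refl ; at-u = refl }

third-even→odd : ∀ {m} → Third m 0 → Third (suc m) 1
third-even→odd {m} t = record
  { u        = u + u
  ; u-spec   = trans (spec u) (cong (2 *_) u-spec)
  ; at-suc-u = trans (double+1-recurrence (3 + m) (2 ^ m) u)
                     (trans (cong₂ (λ s r → s + r + 2 * u) at-suc-u at-u) (step₁ m u))
  ; at-u     = trans (double-recurrence (3 + m) (2 ^ m) u) (trans (cong (λ s → 2 * s + 2 * u) at-u) (step₀ m u))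
  }
  where
  open Third t
  spec : ∀ u → 3 * (u + u) + 1 + 1 ≡ 2 * (3 * u + 1 + 0)
  spec = solve-∀
  step₁ : ∀ m u → (3 + m) * suc u + ((3 + m) * u + 1) + 2 * u ≡ (3 + suc m) * suc (u + u)
  step₁ = solve-∀
  step₀ : ∀ m u → 2 * ((3 + m) * u + 1) + 2 * u ≡ (3 + suc m) * (u + u) + 2
  step₀ = solve-∀

third-odd→even : ∀ {m} → Third m 1 → Third (suc m) 0
third-odd→even {m} t = record
  { u        = suc (u + u)
  ; u-spec   = trans (spec u) (cong (2 *_) u-spec)
  ; at-suc-u = trans (cong (λ s → 2 * innerEdges (4 + m) s + 2 * s + 2 * 2 ^ m) (sym (+-suc (suc u) u)))
                     (trans (double-recurrence (3 + m) (2 ^ m) (suc u))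
                            (trans (cong (λ s → 2 * s + 2 * suc u) at-suc-u) (step₁ m u)))
  ; at-u     = trans (double+1-recurrence (3 + m) (2 ^ m) u)
                     (trans (cong₂ (λ s r → s + r + 2 * u) at-suc-u at-u) (step₀ m u))
  }
  where
  open Third t
  spec : ∀ u → 3 * suc (u + u) + 1 + 0 ≡ 2 * (3 * u + 1 + 1)
  spec = solve-∀
  step₁ : ∀ m u → 2 * ((3 + m) * suc u) + 2 * suc u ≡ (3 + suc m) * suc (suc u + u)
  step₁ = solve-∀
  step₀ : ∀ m u → (3 + m) * suc u + ((3 + m) * u + 2) + 2 * u ≡ (3 + suc m) * suc (u + u) + 1
  step₀ = solve-∀

third : ∀ m → Third m 0 ⊎ Third m 1
third zero = inj₁ third-zero
third (suc m) with third m
... | inj₁ t = inj₂ (third-even→odd t)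
... | inj₂ t = inj₁ (third-odd→even t)

[m*n+o]/n≡m : ∀ m {n o} .{{_ : NonZero n}} → o < n → (m * n + o) / n ≡ m
[m*n+o]/n≡m m {n} {o} o<n = ≤-antisym
  (<⇒≤pred (m<n*o⇒m/o<n (subst (m * n + o <_) (+-comm (m * n) n) (+-monoʳ-< (m * n) o<n))))
  (subst (_≤ (m * n + o) / n) (m*n/n≡m m n) (/-monoˡ-≤ n (m≤m+n (m * n) o)))

module _ {m p : ℕ} (t : Third m p) where
  open Third t

  α≡1+u : p ≤ 1 → (2 ^ (3 + m) + 23) / 24 ≡ suc u
  α≡1+u p≤1 = begin
    (2 ^ (3 + m) + 23) / 24                     ≡⟨ cong (λ s → (2 * (2 * (2 * s)) + 23) / 24) (sym u-spec) ⟩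
    (2 * (2 * (2 * (3 * u + 1 + p))) + 23) / 24 ≡⟨ cong (_/ 24) (split u p) ⟩
    (suc u * 24 + (7 + 8 * p)) / 24             ≡⟨ [m*n+o]/n≡m (suc u) 7+8p<24 ⟩
    suc u                                       ∎
    where
    open ≡-Reasoning
    7+8p<24 : 7 + 8 * p < 24
    7+8p<24 = ≤-trans (+-monoʳ-≤ 8 (*-monoʳ-≤ 8 p≤1)) (m≤m+n 16 8)
    split : ∀ u p → 2 * (2 * (2 * (3 * u + 1 + p))) + 23 ≡ suc u * 24 + (7 + 8 * p)
    split = solve-∀

  1+u≤2^m : suc u ≤ 2 ^ m
  1+u≤2^m = begin
    suc u           ≤⟨ s≤s (m≤m+n u (u + (u + 0))) ⟩
    suc (3 * u)     ≡⟨ +-comm 1 (3 * u) ⟩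
    3 * u + 1       ≤⟨ m≤m+n (3 * u + 1) p ⟩
    3 * u + 1 + p   ≡⟨ u-spec ⟩
    2 ^ m           ∎
    where open ≤-Reasoning

  α-segment : IsTheta (3 + m) (suc u) (2 * suc u + 2 ^ m)
  α-segment = isTheta-initialSegment (3 + m) (suc u) (2 * suc u + 2 ^ m)
    (≤-trans 1+u≤2^m (^-monoʳ-≤ 2 (m≤n+m m 3)))
    (trans (sym (+-assoc (2 * innerEdges (3 + m) (suc u)) _ _)) at-suc-u)

  co-α-segment : IsTheta (3 + m) (2 ^ (2 + m) ∸ suc u) (5 * 2 ^ m)
  co-α-segment = isTheta-initialSegment (3 + m) v (5 * 2 ^ m)
    (≤-trans (m∸n≤m (2 ^ (2 + m)) (suc u)) (^-monoʳ-≤ 2 (n≤1+n (2 + m))))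
    (+-cancelʳ-≡ (2 * h (suc u) + 2 * suc u) _ _ (begin
      2 * h v + 5 * 2 ^ m + (2 * h (suc u) + 2 * suc u)
        ≡⟨ regroup (2 * h v) (2 ^ m) (2 * h (suc u)) (2 * suc u) ⟩
      (2 * h (suc u) + 2 * suc u + 2 ^ m) + 2 ^ (2 + m) + 2 * h v
        ≡⟨ cong (λ s → s + 2 ^ (2 + m) + 2 * h v) at-suc-u ⟩
      (3 + m) * suc u + 2 ^ (2 + m) + 2 * h v
        ≡⟨ sym (innerEdges-lower-complement (2 + m) (suc u) α≤2^[2+m]) ⟩
      (3 + m) * v + 2 * suc u + 2 * h (suc u)
        ≡⟨ +-assoc ((3 + m) * v) _ _ ⟩
      (3 + m) * v + (2 * suc u + 2 * h (suc u))
        ≡⟨ cong ((3 + m) * v +_) (+-comm (2 * suc u) _) ⟩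
      (3 + m) * v + (2 * h (suc u) + 2 * suc u) ∎))
    where
    open ≡-Reasoning
    h : ℕ → ℕ
    h = innerEdges (3 + m)
    v : ℕ
    v = 2 ^ (2 + m) ∸ suc u
    α≤2^[2+m] : suc u ≤ 2 ^ (2 + m)
    α≤2^[2+m] = ≤-trans 1+u≤2^m (^-monoʳ-≤ 2 (m≤n+m m 2))
    regroup : ∀ V P H A → V + 5 * P + (H + A) ≡ (H + A + P) + 2 * (2 * P) + V
    regroup = solve-∀

  theta-values : p ≤ 1 → let α = (2 ^ (3 + m) + 23) / 24 in
    IsTheta (3 + m) α (2 * α + 2 ^ m) × IsTheta (3 + m) (2 ^ (2 + m) ∸ α) (5 * 2 ^ m)
  theta-values p≤1 =
    subst (λ α → IsTheta (3 + m) α (2 * α + 2 ^ m) × IsTheta (3 + m) (2 ^ (2 + m) ∸ α) (5 * 2 ^ m))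
          (sym (α≡1+u p≤1)) (α-segment , co-α-segment)

lemma4p4 : (n : ℕ) → 3 ≤ n →
    let α = (2 ^ n + 23) / 24 in
    IsTheta n α (2 * α + 2 ^ (n ∸ 3))
    × IsTheta n (2 ^ (n ∸ 1) ∸ α) (5 * 2 ^ (n ∸ 3))
lemma4p4 zero                ()
lemma4p4 (suc zero)          (s≤s ())
lemma4p4 (suc (suc zero))    (s≤s (s≤s ()))
lemma4p4 (suc (suc (suc m))) _ with third m
... | inj₁ t = theta-values t z≤n
... | inj₂ t = theta-values t ≤-refl
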